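{- Let $r$ and $c$ be integer sequences of length $m$ and $n$, respectively, and let $M$ be their merge matrix. Let $i$ be an index with $r(i)=\min(r)$ and $j$ an index with $c(j)=\min(c)$. (1) If $i=1$ and $j=n$, then the path $\vec p_{ru}=(1,1),(1,2),\ldots,(1,n),(2,n),\ldots,(m,n)$ dominates every path in $M$. (2) If $i=m$ and $j=1$, then the path $\vec p_{ur}=(1,1),(2,1),\ldots,(m,1),(m,2),\ldots,(m,n)$ dominates every path in $M$.
   Context: The merge matrix of $r$ and $c$ is the $m\times n$ matrix with $M[i,j]=r(i)+c(j)$. A path in $M$ is a sequence $p(1),\ldots,p(L)$ of indices with $p(1)=(1,1)$, $p(L)=(m,n)$, and if $p(h)=(i,j)$ then $p(h+1)\in\{(i+1,j),(i,j+1),(i+1,j+1)\}$; $M[p]=M[p(1)],\ldots,M[p(L)]$. A path $p$ dominates a path $q$ if $M[p]$ dominates $M[q]$, where for integer sequences $a$ dominates $b$ if there are extensions $a^*$ of $a$ and $b^*$ of $b$ of equal length with $a^*(k)\le b^*(k)$ for all $k$; an extension of a sequence is obtained by repeating each of its elements one or more times consecutively, preserving order. -}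

module Defs where

open import Data.Nat using (ℕ; zero; suc; _≥_)
open import Data.Integer using (ℤ; _+_; _≤_)
open import Data.Fin using (Fin; zero; suc; toℕ; fromℕ)
open import Data.Product using (_×_; _,_; Σ; ∃; ∃-syntax)
open import Data.Sum using (_⊎_)
open import Data.Maybe using (Maybe; just)
open import Data.List using (List; map; head; last; length; concat; zipWith; replicate; allFin; _++_)
open import Data.List.Relation.Unary.All using (All)
open import Data.List.Relation.Unary.Linked using (Linked)
open import Data.List.Relation.Binary.Pointwise using (Pointwise)
open import Relation.Binary.PropositionalEquality using (_≡_)

-- Conventions: a sequence of length m is a function Fin m → ℤ (0-based
-- positions).  Paths need m, n ≥ 1, so rows are Fin (suc m) and columns
-- Fin (suc n) (i.e. the sequences have lengths suc m and suc n).

Pos : ℕ → ℕ → Set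
Pos m n = Fin (suc m) × Fin (suc n)

merge : ∀ {m n} → (Fin (suc m) → ℤ) → (Fin (suc n) → ℤ) → Pos m n → ℤ
merge r c (i , j) = r i + c j

Step : ∀ {m n} → Pos m n → Pos m n → Set
Step (i , j) (i′ , j′) =
  (toℕ i′ ≡ suc (toℕ i) × j′ ≡ j)
  ⊎ (i′ ≡ i × toℕ j′ ≡ suc (toℕ j))
  ⊎ (toℕ i′ ≡ suc (toℕ i) × toℕ j′ ≡ suc (toℕ j))

IsPath : ∀ m n → List (Pos m n) → Set
IsPath m n p =
  head p ≡ just (zero , zero)
  × last p ≡ just (fromℕ m , fromℕ n)
  × Linked Step p

values : ∀ {m n} → (Fin (suc m) → ℤ) → (Fin (suc n) → ℤ) → List (Pos m n) → List ℤ
values r c p = map (merge r c) p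

Extension : List ℤ → List ℤ → Set
Extension a b =
  Σ (List ℕ) λ ks →
    length ks ≡ length a × All (λ k → k ≥ 1) ks
    × b ≡ concat (zipWith replicate ks a)

Dominates : List ℤ → List ℤ → Set
Dominates a b =
  ∃[ a* ] ∃[ b* ] Extension a a* × Extension b b* × Pointwise _≤_ a* b*

PathDominates : ∀ {m n} → (Fin (suc m) → ℤ) → (Fin (suc n) → ℤ)
              → List (Pos m n) → List (Pos m n) → Set
PathDominates r c p q = Dominates (values r c p) (values r c q)

p-ru : ∀ m n → List (Pos m n)
p-ru m n = map (λ j → (zero , j)) (allFin (suc n))
        ++ map (λ i → (suc i , fromℕ n)) (allFin m)

p-ur : ∀ m n → List (Pos m n)
p-ur m n = map (λ i → (i , zero)) (allFin (suc m))
        ++ map (λ j → (fromℕ m , suc j)) (allFin n)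

IsMinIndex : ∀ {k} → (Fin k → ℤ) → Fin k → Set
IsMinIndex s i = ∀ k → s i ≤ s k

-- Let x be a point of the path q where M is maximal.  Along p_ru the entries
-- r(1) + c(j) of the first row are bounded by every entry of column j, and the
-- entries r(i) + c(n) of the last column by every entry of row i.  Since q
-- passes through every column and every row, all entries of p_ru are bounded
-- by M[x].  So p_ru is warped against q as follows: before x, match the first
-- row column by column; at x, absorb the rest of the first row and the last
-- column up to the row of x; after x, match the last column row by row.
-- Part (2) is part (1) for the transposed matrix.
module Submission where

open import Defs
open import Data.Nat using (ℕ; suc)
open import Data.Integer using (ℤ)
open import Data.Fin using (Fin; zero; fromℕ)
open import Data.Product using (_×_)
open import Data.List using (List)

import Data.Nat as ℕ
open import Data.Nat using (_+_; _∸_; z≤n; s≤s)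
import Data.Nat.Properties as ℕₚ
open import Data.Integer using (_≤_)
import Data.Integer.Properties as ℤₚ
import Data.Fin as Fin
import Data.Fin.Properties as Finₚ
open import Data.Product using (∃; _,_; swap)
open import Data.Sum using (_⊎_; inj₁; inj₂; [_,_]′)
open import Function using (_∘_; id)
open import Data.Empty using (⊥-elim)
import Data.Maybe as Maybe
open import Data.Maybe using (just)
import Data.Maybe.Properties as Maybeₚ
open import Data.List using ([]; _∷_; _++_; map; last; allFin; tabulate)
open import Data.List.Properties using (map-++; map-∘; ++-assoc; map-tabulate; map-cong; last-map)
open import Data.List.Relation.Unary.All using (All; []; _∷_; lookupAny)
import Data.List.Relation.Unary.All.Properties as Allₚ
open import Data.List.Relation.Unary.Any using (Any; here; there)
open import Data.List.Relation.Binary.Pointwise using ([]; _∷_)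
import Data.List.Relation.Unary.Linked as Linked
open import Data.List.Relation.Unary.Linked using (Linked; _∷_)
import Data.List.Relation.Unary.Linked.Properties as Linkedₚ
open import Data.List.Membership.Propositional using (_∈_)
open import Data.List.Extrema ℤₚ.≤-totalOrder using (argmax; argmax-sel; f[⊥]≤f[argmax]; f[xs]≤f[argmax])
open import Relation.Binary.PropositionalEquality using (_≡_; refl; sym; trans; cong; cong₂; subst; subst₂; module ≡-Reasoning)
open import Relation.Nullary using (yes; no)

data Warp : List ℤ → List ℤ → Set where
  done  : ∀ {x y} → x ≤ y → Warp (x ∷ []) (y ∷ [])
  nextˡ : ∀ {x y as bs} → x ≤ y → Warp as (y ∷ bs) → Warp (x ∷ as) (y ∷ bs)
  nextʳ : ∀ {x y as bs} → x ≤ y → Warp (x ∷ as) bs → Warp (x ∷ as) (y ∷ bs)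
  next  : ∀ {x y as bs} → x ≤ y → Warp as bs → Warp (x ∷ as) (y ∷ bs)

extension-[] : Extension [] []
extension-[] = [] , refl , [] , refl

extension-∷ : ∀ {x a a*} → Extension a a* → Extension (x ∷ a) (x ∷ a*)
extension-∷ (ks , len , ks≥1 , eq) = 1 ∷ ks , cong suc len , s≤s z≤n ∷ ks≥1 , cong (_ ∷_) eq

extension-repeat : ∀ {x a a*} → Extension (x ∷ a) a* → Extension (x ∷ a) (x ∷ a*)
extension-repeat ([] , () , _)
extension-repeat (k ∷ ks , len , _ ∷ ks≥1 , eq) = suc k ∷ ks , len , s≤s z≤n ∷ ks≥1 , cong (_ ∷_) eq

Warp⇒Dominates : ∀ {a b} → Warp a b → Dominates a b
Warp⇒Dominates (done x≤y) =
  _ , _ , extension-∷ extension-[] , extension-∷ extension-[] , x≤y ∷ []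
Warp⇒Dominates (nextˡ x≤y w) with Warp⇒Dominates w
... | _ , _ , ea , eb , a*≤b* = _ , _ , extension-∷ ea , extension-repeat eb , x≤y ∷ a*≤b*
Warp⇒Dominates (nextʳ x≤y w) with Warp⇒Dominates w
... | _ , _ , ea , eb , a*≤b* = _ , _ , extension-repeat ea , extension-∷ eb , x≤y ∷ a*≤b*
Warp⇒Dominates (next x≤y w) with Warp⇒Dominates w
... | _ , _ , ea , eb , a*≤b* = _ , _ , extension-∷ ea , extension-∷ eb , x≤y ∷ a*≤b*

absorb : ∀ {y bs} xs {as} → All (_≤ y) xs → Warp as (y ∷ bs) → Warp (xs ++ as) (y ∷ bs)
absorb []       []           w = w
absorb (x ∷ xs) (x≤y ∷ xs≤y) w = nextˡ x≤y (absorb xs xs≤y w)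

range : ℕ → ℕ → List ℕ
range b ℕ.zero  = []
range b (suc d) = b ∷ range (suc b) d

range-∷ʳ : ∀ b d → range b (suc d) ≡ range b d ++ (b + d ∷ [])
range-∷ʳ b ℕ.zero  = cong (_∷ []) (sym (ℕₚ.+-identityʳ b))
range-∷ʳ b (suc d) = cong (b ∷_) (trans (range-∷ʳ (suc b) d)
  (cong (λ k → range (suc b) d ++ (k ∷ [])) (sym (ℕₚ.+-suc b d))))

range-++ : ∀ b d e → range b (d + e) ≡ range b d ++ range (b + d) e
range-++ b ℕ.zero  e = cong (λ k → range k e) (sym (ℕₚ.+-identityʳ b))
range-++ b (suc d) e = cong (b ∷_) (trans (range-++ (suc b) d e)
  (cong (λ k → range (suc b) d ++ range k e) (sym (ℕₚ.+-suc b d))))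

range-all : ∀ {P : ℕ → Set} b d → (∀ k → k ℕ.< b + d → P k) → All P (range b d)
range-all b ℕ.zero  _ = []
range-all b (suc d) p = p b (ℕₚ.m<m+n b ℕ.z<s)
  ∷ range-all (suc b) d (λ k k< → p k (subst (k ℕ.<_) (sym (ℕₚ.+-suc b d)) k<))

step-within : ∀ {J d N} → J + d ≡ N → suc J ℕ.≤ N → ∃ λ d′ → d ≡ suc d′ × suc J + d′ ≡ N
step-within {J} {ℕ.zero}  J+0≡N J<N = ⊥-elim (ℕₚ.<-irrefl (trans (sym (ℕₚ.+-identityʳ J)) J+0≡N) J<N)
step-within {J} {suc d}   J+d≡N _   = d , refl , trans (sym (ℕₚ.+-suc J d)) J+d≡N

lastOf : ∀ {A : Set} → A → List A → A
lastOf y []      = y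
lastOf _ (z ∷ L) = lastOf z L

last-∷ : ∀ {A : Set} (y : A) L → last (y ∷ L) ≡ just (lastOf y L)
last-∷ y []      = refl
last-∷ _ (z ∷ L) = last-∷ z L

UnitSteps : ∀ {A : Set} → (A → A → Set) → (A → ℕ) → Set
UnitSteps S κ = ∀ {a b} → S a b → κ b ≡ κ a ⊎ κ b ≡ suc (κ a)

visits : ∀ {A : Set} {S : A → A → Set} {κ : A → ℕ} → UnitSteps S κ
       → ∀ {y L} → Linked S (y ∷ L) → ∀ {k} → κ y ℕ.≤ k → k ℕ.≤ κ (lastOf y L)
       → Any (λ z → κ z ≡ k) (y ∷ L)
visits steps {L = []}    _        y≤k k≤y = here (ℕₚ.≤-antisym y≤k k≤y)
visits {κ = κ} steps {y} {z ∷ L} (s ∷ lk) {k} y≤k k≤last with κ y ℕ.≟ k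
... | yes y≡k = here y≡k
... | no  y≢k = there (visits steps lk z≤k k≤last)
  where
    z≤k : κ z ℕ.≤ k
    z≤k = [ (λ same → subst (ℕ._≤ k) (sym same) y≤k)
          , (λ up → subst (ℕ._≤ k) (sym up) (ℕₚ.≤∧≢⇒< y≤k y≢k)) ]′ (steps s)

module Staircase
  {A : Set} (S : A → A → Set) (v : A → ℤ)
  (κ₁ κ₂ : A → ℕ) (steps₁ : UnitSteps S κ₁) (steps₂ : UnitSteps S κ₂)
  (N₁ N₂ : ℕ) (κ₁≤N₁ : ∀ a → κ₁ a ℕ.≤ N₁) (κ₂≤N₂ : ∀ a → κ₂ a ℕ.≤ N₂)
  (f g : ℕ → ℤ) (f≤v : ∀ a → f (κ₁ a) ≤ v a) (g≤v : ∀ a → g (κ₂ a) ≤ v a)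
  (corner : f N₁ ≡ g 0)
  where

  -- For the merge matrix, κ₁ and κ₂ are column and row, f is the first row and
  -- g the last column, so staircaseFrom 0 N₁ is M[p_ru].

  staircaseFrom : ℕ → ℕ → List ℤ
  staircaseFrom J d = map f (range J (suc d)) ++ map g (range 1 N₂)

  ≤v-at : ∀ (κ : A → ℕ) (h : ℕ → ℤ) → (∀ a → h (κ a) ≤ v a) → ∀ {a k} → κ a ≡ k → h k ≤ v a
  ≤v-at κ h h≤v refl = h≤v _

  f≤v-at : ∀ {a k} → κ₁ a ≡ k → f k ≤ v a
  f≤v-at = ≤v-at κ₁ f f≤v

  g≤v-at : ∀ {a k} → κ₂ a ≡ k → g k ≤ v a
  g≤v-at = ≤v-at κ₂ g g≤v

  bounded-by-sweep : ∀ (κ : A → ℕ) (h : ℕ → ℤ) → UnitSteps S κ → (∀ a → h (κ a) ≤ v a)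
                   → ∀ {y L b} → Linked S (y ∷ L) → All (λ z → v z ≤ b) (y ∷ L)
                   → ∀ k → κ y ℕ.≤ k → k ℕ.≤ κ (lastOf y L) → h k ≤ b
  bounded-by-sweep κ h steps h≤v lk ≤b k y≤k k≤last
    with lookupAny ≤b (visits {κ = κ} steps lk y≤k k≤last)
  ... | vz≤b , κz≡k = ℤₚ.≤-trans (≤v-at κ h h≤v κz≡k) vz≤b

  trace₂ : ∀ y L I e → Linked S (y ∷ L) → κ₂ y ≡ I → I + e ≡ N₂ → κ₂ (lastOf y L) ≡ N₂
         → Warp (map g (range I (suc e))) (map v (y ∷ L))
  trace₂ y []      I ℕ.zero  _ y≡I _       _   = done (g≤v-at y≡I)
  trace₂ y []      I (suc e) _ y≡I I+e≡N y≡N =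
    ⊥-elim (ℕₚ.m+1+n≢m I (trans I+e≡N (trans (sym y≡N) y≡I)))
  trace₂ y (z ∷ L) I e (s ∷ lk) y≡I I+e≡N last≡N with steps₂ s
  ... | inj₁ same = nextʳ (g≤v-at y≡I) (trace₂ z L I e lk (trans same y≡I) I+e≡N last≡N)
  ... | inj₂ up with step-within I+e≡N (subst (ℕ._≤ N₂) (trans up (cong suc y≡I)) (κ₂≤N₂ z))
  ...   | e′ , refl , I+1+e′≡N =
    next (g≤v-at y≡I) (trace₂ z L (suc I) e′ lk (trans up (cong suc y≡I)) I+1+e′≡N last≡N)

  module _ (x : A) (f≤vx : ∀ k → k ℕ.≤ N₁ → f k ≤ v x) (g≤vx : ∀ k → k ℕ.≤ N₂ → g k ≤ v x) where

    map-range-≤ : ∀ {h N} → (∀ k → k ℕ.≤ N → h k ≤ v x)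
                → ∀ b d → b + d ℕ.≤ suc N → All (_≤ v x) (map h (range b d))
    map-range-≤ h≤vx b d b+d≤1+N = Allₚ.map⁺ (range-all b d (λ k k<b+d →
      h≤vx k (ℕₚ.≤-pred (ℕₚ.≤-trans k<b+d b+d≤1+N))))

    -- When x lies in row 0, the corner f N₁ = g 0 is matched by the trace
    -- along the last column rather than absorbed by x.
    switch : ∀ {bs} J d I e → J + d ≡ N₁ → I + e ≡ N₂
           → Warp (map g (range I (suc e))) (v x ∷ bs) → Warp (staircaseFrom J d) (v x ∷ bs)
    switch {bs} J d ℕ.zero _ J+d≡N refl w =
      subst (λ a → Warp a (v x ∷ bs)) (sym split)
        (absorb (map f (range J d)) (map-range-≤ f≤vx J d (ℕₚ.m≤n⇒m≤1+n (ℕₚ.≤-reflexive J+d≡N))) w)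
      where
        open ≡-Reasoning
        split : staircaseFrom J d ≡ map f (range J d) ++ map g (range 0 (suc N₂))
        split = begin
          map f (range J (suc d)) ++ map g (range 1 N₂)
            ≡⟨ cong (λ ks → map f ks ++ map g (range 1 N₂)) (range-∷ʳ J d) ⟩
          map f (range J d ++ (J + d ∷ [])) ++ map g (range 1 N₂)
            ≡⟨ cong (_++ map g (range 1 N₂)) (map-++ f (range J d) _) ⟩
          (map f (range J d) ++ (f (J + d) ∷ [])) ++ map g (range 1 N₂)
            ≡⟨ ++-assoc (map f (range J d)) _ _ ⟩
          map f (range J d) ++ (f (J + d) ∷ map g (range 1 N₂))
            ≡⟨ cong (λ y → map f (range J d) ++ (y ∷ map g (range 1 N₂))) (trans (cong f J+d≡N) corner) ⟩
          map f (range J d) ++ map g (range 0 (suc N₂)) ∎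
    switch {bs} J d (suc I) e J+d≡N I+e≡N w =
      subst (λ a → Warp a (v x ∷ bs)) (sym split)
        (absorb (map f (range J (suc d)) ++ map g (range 1 I)) (Allₚ.++⁺ fs≤vx gs≤vx) w)
      where
        open ≡-Reasoning
        split : staircaseFrom J d
              ≡ (map f (range J (suc d)) ++ map g (range 1 I)) ++ map g (range (suc I) (suc e))
        split = begin
          map f (range J (suc d)) ++ map g (range 1 N₂)
            ≡⟨ cong (λ n → map f (range J (suc d)) ++ map g (range 1 n))
                    (trans (sym I+e≡N) (sym (ℕₚ.+-suc I e))) ⟩
          map f (range J (suc d)) ++ map g (range 1 (I + suc e))
            ≡⟨ cong (λ ks → map f (range J (suc d)) ++ map g ks) (range-++ 1 I (suc e)) ⟩
          map f (range J (suc d)) ++ map g (range 1 I ++ range (suc I) (suc e))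
            ≡⟨ cong (map f (range J (suc d)) ++_) (map-++ g (range 1 I) _) ⟩
          map f (range J (suc d)) ++ (map g (range 1 I) ++ map g (range (suc I) (suc e)))
            ≡⟨ sym (++-assoc (map f (range J (suc d))) _ _) ⟩
          (map f (range J (suc d)) ++ map g (range 1 I)) ++ map g (range (suc I) (suc e)) ∎
        fs≤vx : All (_≤ v x) (map f (range J (suc d)))
        fs≤vx = map-range-≤ f≤vx J (suc d) (ℕₚ.≤-reflexive (trans (ℕₚ.+-suc J d) (cong suc J+d≡N)))
        gs≤vx : All (_≤ v x) (map g (range 1 I))
        gs≤vx = map-range-≤ g≤vx 1 I
          (ℕₚ.m≤n⇒m≤1+n (subst (suc I ℕ.≤_) I+e≡N (ℕₚ.m≤m+n (suc I) e)))

    trace₁ : ∀ y L J d → Linked S (y ∷ L) → κ₁ y ≡ J → J + d ≡ N₁ → κ₂ (lastOf y L) ≡ N₂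
           → x ∈ y ∷ L → Warp (staircaseFrom J d) (map v (y ∷ L))
    trace₁ _ L J d lk _ J+d≡N last≡N (here refl) =
      switch J d (κ₂ x) (N₂ ∸ κ₂ x) J+d≡N x+rest≡N
        (trace₂ x L (κ₂ x) (N₂ ∸ κ₂ x) lk refl x+rest≡N last≡N)
      where
        x+rest≡N : κ₂ x + (N₂ ∸ κ₂ x) ≡ N₂
        x+rest≡N = ℕₚ.m+[n∸m]≡n (κ₂≤N₂ x)
    trace₁ y []      J d _        _   _     _      (there ())
    trace₁ y (z ∷ L) J d (s ∷ lk) y≡J J+d≡N last≡N (there x∈) with steps₁ s
    ... | inj₁ same = nextʳ (f≤v-at y≡J) (trace₁ z L J d lk (trans same y≡J) J+d≡N last≡N x∈)
    ... | inj₂ up with step-within J+d≡N (subst (ℕ._≤ N₁) (trans up (cong suc y≡J)) (κ₁≤N₁ z))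
    ...   | d′ , refl , J+1+d′≡N =
      next (f≤v-at y≡J) (trace₁ z L (suc J) d′ lk (trans up (cong suc y≡J)) J+1+d′≡N last≡N x∈)

  staircase-warp : ∀ y L → Linked S (y ∷ L) → κ₁ y ≡ 0 → κ₂ y ≡ 0
                 → κ₁ (lastOf y L) ≡ N₁ → κ₂ (lastOf y L) ≡ N₂
                 → Warp (staircaseFrom 0 N₁) (map v (y ∷ L))
  staircase-warp y L lk y₁≡0 y₂≡0 last₁≡N last₂≡N =
    trace₁ x f≤vx g≤vx y L 0 N₁ lk y₁≡0 refl last₂≡N x∈
    where
      x : A
      x = argmax v y L
      x∈ : x ∈ y ∷ L
      x∈ = [ here , there ]′ (argmax-sel v y L)
      ≤vx : All (λ z → v z ≤ v x) (y ∷ L)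
      ≤vx = f[⊥]≤f[argmax] {f = v} y L ∷ f[xs]≤f[argmax] {f = v} y L
      f≤vx : ∀ k → k ℕ.≤ N₁ → f k ≤ v x
      f≤vx k k≤N = bounded-by-sweep κ₁ f steps₁ f≤v lk ≤vx k
        (subst (ℕ._≤ k) (sym y₁≡0) z≤n) (subst (k ℕ.≤_) (sym last₁≡N) k≤N)
      g≤vx : ∀ k → k ℕ.≤ N₂ → g k ≤ v x
      g≤vx k k≤N = bounded-by-sweep κ₂ g steps₂ g≤v lk ≤vx k
        (subst (ℕ._≤ k) (sym y₂≡0) z≤n) (subst (k ℕ.≤_) (sym last₂≡N) k≤N)

-- clamp n k is k as an element of Fin (suc n), cut off at n; only k ≤ n is ever used.
clamp : ∀ n → ℕ → Fin (suc n)
clamp n       ℕ.zero  = zero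
clamp ℕ.zero  (suc k) = zero
clamp (suc n) (suc k) = Fin.suc (clamp n k)

clamp-toℕ : ∀ n (i : Fin (suc n)) → clamp n (Fin.toℕ i) ≡ i
clamp-toℕ n       zero        = refl
clamp-toℕ (suc n) (Fin.suc i) = cong Fin.suc (clamp-toℕ n i)

clamp-suc : ∀ n (i : Fin n) → clamp n (suc (Fin.toℕ i)) ≡ Fin.suc i
clamp-suc (suc n) i = cong Fin.suc (clamp-toℕ n i)

tabulate≡map-range : ∀ {A : Set} {k} (h : Fin k → A) (h′ : ℕ → A) b
                   → (∀ i → h i ≡ h′ (b + Fin.toℕ i)) → tabulate h ≡ map h′ (range b k)
tabulate≡map-range {k = ℕ.zero}  h h′ b eq = refl
tabulate≡map-range {k = suc k}   h h′ b eq = cong₂ _∷_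
  (trans (eq zero) (cong h′ (ℕₚ.+-identityʳ b)))
  (tabulate≡map-range (h ∘ Fin.suc) h′ (suc b)
    (λ i → trans (eq (Fin.suc i)) (cong h′ (ℕₚ.+-suc b (Fin.toℕ i)))))

map-map-allFin : ∀ {A B : Set} k (h : Fin k → A) (F : A → B) → map F (map h (allFin k)) ≡ tabulate (F ∘ h)
map-map-allFin k h F = trans (sym (map-∘ (allFin k))) (map-tabulate id (F ∘ h))

module _ {m n : ℕ} where

  column row : Pos m n → ℕ
  column (_ , j) = Fin.toℕ j
  row    (i , _) = Fin.toℕ i

  column-steps : UnitSteps Step column
  column-steps (inj₁ (_ , j′≡j))      = inj₁ (cong Fin.toℕ j′≡j)
  column-steps (inj₂ (inj₁ (_ , up))) = inj₂ up
  column-steps (inj₂ (inj₂ (_ , up))) = inj₂ up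

  row-steps : UnitSteps Step row
  row-steps (inj₁ (up , _))           = inj₂ up
  row-steps (inj₂ (inj₁ (i′≡i , _)))  = inj₁ (cong Fin.toℕ i′≡i)
  row-steps (inj₂ (inj₂ (up , _)))    = inj₂ up

  IsPath-endpoints : ∀ {y L} → IsPath m n (y ∷ L) → y ≡ (zero , zero) × lastOf y L ≡ (fromℕ m , fromℕ n)
  IsPath-endpoints {y} {L} (head≡ , last≡ , _) =
    Maybeₚ.just-injective head≡ , Maybeₚ.just-injective (trans (sym (last-∷ y L)) last≡)

  Step-swap : ∀ {a b : Pos m n} → Step a b → Step (swap a) (swap b)
  Step-swap (inj₁ step)        = inj₂ (inj₁ (swap step))
  Step-swap (inj₂ (inj₁ step)) = inj₁ (swap step)
  Step-swap (inj₂ (inj₂ step)) = inj₂ (inj₂ (swap step))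

  IsPath-swap : ∀ {q} → IsPath m n q → IsPath n m (map swap q)
  IsPath-swap {[]}    (() , _)
  IsPath-swap {y ∷ L} (head≡ , last≡ , linked) =
    cong (Maybe.map swap) head≡ ,
    trans (last-map swap (y ∷ L)) (cong (Maybe.map swap) last≡) ,
    Linkedₚ.map⁺ (Linked.map Step-swap linked)

  module _ (r : Fin (suc m) → ℤ) (c : Fin (suc n) → ℤ) where

    firstRow lastColumn : ℕ → ℤ
    firstRow   k = merge r c (zero , clamp n k)
    lastColumn k = merge r c (clamp m k , fromℕ n)

    values-p-ru : values r c (p-ru m n) ≡ map firstRow (range 0 (suc n)) ++ map lastColumn (range 1 m)
    values-p-ru = trans (map-++ (merge r c) (map (λ j → (zero , j)) (allFin (suc n))) _) (cong₂ _++_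
      (trans (map-map-allFin (suc n) _ (merge r c)) (tabulate≡map-range _ firstRow 0
        (λ j → cong (λ j′ → merge r c (zero , j′)) (sym (clamp-toℕ n j)))))
      (trans (map-map-allFin m _ (merge r c)) (tabulate≡map-range _ lastColumn 1
        (λ i → cong (λ i′ → merge r c (i′ , fromℕ n)) (sym (clamp-suc m i))))))

    values-swap : ∀ q → values c r (map swap q) ≡ values r c q
    values-swap q = trans (sym (map-∘ q)) (map-cong (λ (i , j) → ℤₚ.+-comm (c j) (r i)) q)

p-ru-transpose : ∀ m n → p-ru n m ≡ map swap (p-ur m n)
p-ru-transpose m n = sym (trans (map-++ swap (map (λ i → (i , zero)) (allFin (suc m))) _)
  (cong₂ _++_ (sym (map-∘ (allFin (suc m)))) (sym (map-∘ (allFin n)))))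

p-ru-dominates : ∀ m n (r : Fin (suc m) → ℤ) (c : Fin (suc n) → ℤ)
               → IsMinIndex r zero → IsMinIndex c (fromℕ n)
               → ∀ q → IsPath m n q → PathDominates r c (p-ru m n) q
p-ru-dominates m n r c r-min c-min []      (() , _)
p-ru-dominates m n r c r-min c-min (y ∷ L) path@(_ , _ , linked) with IsPath-endpoints path
... | start , end =
  Warp⇒Dominates (subst (λ a → Warp a (values r c (y ∷ L))) (sym (values-p-ru r c))
    (staircase-warp y L linked (cong column start) (cong row start)
      (trans (cong column end) (Finₚ.toℕ-fromℕ n)) (trans (cong row end) (Finₚ.toℕ-fromℕ m))))
  where
    firstRow≤ : ∀ a → firstRow r c (column a) ≤ merge r c a
    firstRow≤ (i , j) rewrite clamp-toℕ n j = ℤₚ.+-monoˡ-≤ (c j) (r-min i)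

    lastColumn≤ : ∀ a → lastColumn r c (row a) ≤ merge r c a
    lastColumn≤ (i , j) rewrite clamp-toℕ m i = ℤₚ.+-monoʳ-≤ (r i) (c-min j)

    corner : firstRow r c n ≡ lastColumn r c 0
    corner = cong (λ j → merge r c (zero , j))
      (trans (cong (clamp n) (sym (Finₚ.toℕ-fromℕ n))) (clamp-toℕ n (fromℕ n)))

    open Staircase Step (merge r c) column row column-steps row-steps n m
      (λ (_ , j) → Finₚ.toℕ≤pred[n] j) (λ (i , _) → Finₚ.toℕ≤pred[n] i)
      (firstRow r c) (lastColumn r c) firstRow≤ lastColumn≤ corner

p-ur-dominates : ∀ m n (r : Fin (suc m) → ℤ) (c : Fin (suc n) → ℤ)
               → IsMinIndex r (fromℕ m) → IsMinIndex c zero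
               → ∀ q → IsPath m n q → PathDominates r c (p-ur m n) q
p-ur-dominates m n r c r-min c-min q path =
  subst₂ Dominates
    (trans (cong (values c r) (p-ru-transpose m n)) (values-swap r c (p-ur m n)))
    (values-swap r c q)
    (p-ru-dominates n m c r c-min r-min (map swap q) (IsPath-swap path))

lemma3p6 : (m n : ℕ) (r : Fin (suc m) → ℤ) (c : Fin (suc n) → ℤ)
    → ((IsMinIndex r zero × IsMinIndex c (fromℕ n))
        → ∀ (q : List (Pos m n)) → IsPath m n q → PathDominates r c (p-ru m n) q)
    × ((IsMinIndex r (fromℕ m) × IsMinIndex c zero)
        → ∀ (q : List (Pos m n)) → IsPath m n q → PathDominates r c (p-ur m n) q)
lemma3p6 m n r c =
  (λ (r-min , c-min) → p-ru-dominates m n r c r-min c-min) ,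
  (λ (r-min , c-min) → p-ur-dominates m n r c r-min c-min)
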